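{- Let $X$ be a finite nonempty set, let $C$ be a simplicial complex with $\bigcup C\subseteq X$, let $n\geq 0$, let $B_0$ be a building set of $C$, and for $1\leq i\leq n$ let $B_i$ be a building set of $\widetilde{\mathcal N}(C,B_0,\ldots,B_{i-1})$. Then the function $\mu_X^n\circ\sigma_X^{n+1}$ underlies an isomorphism between the simplicial complexes $\widetilde{\mathcal N}(C,B_0,\ldots,B_n)$ and $\mathrm{Ss}_X(C,B_0,\ldots,B_n)$.
   Context: A (finite abstract) simplicial complex is a set $C=P(\alpha_1)\cup\ldots\cup P(\alpha_m)$, $m\geq1$, where $P(\alpha)$ is the power set of $\alpha$ and $\alpha_1,\ldots,\alpha_m$ are finite, pairwise $\subseteq$-incomparable sets (the bases of $C$). For a function $f$ and a set $S$, $f[S]=\{f(s)\mid s\in S\}$. Simplicial complexes $C,D$ are isomorphic via a bijection $\varphi:\bigcup C\to\bigcup D$ such that $\alpha\in C$ iff $\varphi[\alpha]\in D$; a function $\psi$ underlies an isomorphism between $C$ and $D$ if its restriction to $\bigcup C$ is such a bijection. For a family of sets $B$ and a set $\beta$, $B_\beta=B\cap P(\beta)$. For a finite set $\alpha$, a building set of $P(\alpha)$ is a set $B$ of nonempty subsets of $\alpha$ such that (B1) if $\beta,\gamma\in B$ and $\beta\cap\gamma\neq\emptyset$ then $\beta\cup\gamma\in B$, and (B2) $\{a\}\in B$ for every $a\in\alpha$. A building set of a simplicial complex $C$ with bases $\alpha_1,\ldots,\alpha_m$ is a set $B\subseteq C$ such that $B_{\alpha_i}$ is a building set of $P(\alpha_i)$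 for every $i$. For a family $N$, an $N$-antichain is a set $\{\beta_1,\ldots,\beta_t\}\subseteq N$ with $t\geq2$ whose members are pairwise $\subseteq$-incomparable. For $B$ a building set of $C$, a subset $N\subseteq B$ is nested if for every $N$-antichain $\{\beta_1,\ldots,\beta_t\}$ the union $\beta_1\cup\ldots\cup\beta_t$ belongs to $C- B$. $\widetilde{\mathcal N}(C,B)$ is the simplicial complex of all nested subsets of $B$. Iteratively, if $B_{i+1}$ is a building set of $\widetilde{\mathcal N}(C,B_0,\ldots,B_i)$, then $\widetilde{\mathcal N}(C,B_0,\ldots,B_{i+1})=\widetilde{\mathcal N}(\widetilde{\mathcal N}(C,B_0,\ldots,B_i),B_{i+1})$. For a set $Y$, $TY$ is the free commutative semigroup (without identity) generated by $Y$: its elements are formal sums $k_1y_1+\ldots+k_ry_r$ with $r\geq1$, distinct $y_j\in Y$ and positive integers $k_j$; each $y\in Y$ is identified with $1y\in TY$. $T^1Y=TY$, $T^{m+1}Y=T(T^mY)$, and the formal addition of $T^mY$ is written $+^m$. For $f:Y\to Z$, $Tf:TY\to TZ$ is the semigroup homomorphism extending $f$. $P_FY$ is the set of finite nonempty subsets of $Y$, and $P_Ff(A)=f[A]$. $\sigma_Y:P_FY\to TY$ maps $\{a_1,\ldots,a_k\}$ (distinct $a_j$) to $a_1+\ldots+a_k$; $\sigma^1_Y=\sigma_Y$ and $\sigma^{m+1}_Y=\sigma_{T^mY}\circ P_F\sigma^m_Y:P_F^{m+1}Y\to T^{m+1}Y$. $\mu_Y:T^2Y\to TY$ is the semigroup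 homomorphism extending the identity of $TY$ (it evaluates $+^2$ as $+$); $\mu^0_Y$ is the identity of $TY$ and $\mu^m_Y=\mu_Y\circ T\mu^{m-1}_Y:T^{m+1}Y\to TY$. For $C$ with $\bigcup C\subseteq Y$ and $B_0,\ldots,B_n$ as in the claim: $\mathrm{St}_Y(C,B_0,\ldots,B_n)=\{\sigma^{n+1}_Y[N]\mid N\in\widetilde{\mathcal N}(C,B_0,\ldots,B_n)\}$ and $\mathrm{Ss}_Y(C,B_0,\ldots,B_n)=\{\mu^n_Y[\alpha]\mid \alpha\in \mathrm{St}_Y(C,B_0,\ldots,B_n)\}$. -}

module Defs where

open import Data.Nat using (ℕ; zero; suc; _≤_; _≡ᵇ_)
open import Data.Fin using (Fin)
import Data.Fin.Properties as FinP
open import Data.Bool using (Bool; true; false; _∧_; if_then_else_)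
open import Data.List.Base using (List; []; _∷_; _++_; map; concat; length; lookup)
open import Data.List.Relation.Unary.All using (All)
open import Data.List.Relation.Unary.Any using (Any)
open import Data.Product using (Σ; _×_; ∃; ∃-syntax)
open import Relation.Binary.PropositionalEquality using (_≡_; _≢_)
open import Relation.Nullary using (¬_; does)
open import Function using (_∘_; id)

-- A small universe of "hereditarily finite" types over X = Fin (suc k).
--   base k : the finite nonempty set X = Fin (suc k)
--   P A    : finite subsets of A, represented by lists (order and
--            repetitions irrelevant: equality is extensional, see eq)
--   T A    : formal sums (finite multisets) over A, represented by lists
--            (order irrelevant, multiplicity = number of occurrences)

data Ty : Set where
  base : ℕ → Ty
  P    : Ty → Ty
  T    : Ty → Ty

El : Ty → Set
El (base k) = Fin (suc k)
El (P A)    = List (El A)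
El (T A)    = List (El A)

allB : {Z : Set} → (Z → Bool) → List Z → Bool
allB p []       = true
allB p (x ∷ xs) = p x ∧ allB p xs

mutual
  eq : (A : Ty) → El A → El A → Bool
  eq (base k) x y = does (x FinP.≟ y)
  eq (P A) xs ys  = sub A xs ys ∧ sub A ys xs
  eq (T A) xs ys  = allB (λ z → count A z xs ≡ᵇ count A z ys) (xs ++ ys)

  mem : (A : Ty) → El A → List (El A) → Bool
  mem A x []       = false
  mem A x (y ∷ ys) = if eq A x y then true else mem A x ys

  sub : (A : Ty) → List (El A) → List (El A) → Bool
  sub A []       ys = true
  sub A (x ∷ xs) ys = mem A x ys ∧ sub A xs ys

  count : (A : Ty) → El A → List (El A) → ℕ
  count A z []       = 0
  count A z (y ∷ ys) = if eq A z y then suc (count A z ys) else count A z ys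

Eq : (A : Ty) → El A → El A → Set
Eq A x y = eq A x y ≡ true

Mem : (A : Ty) → El A → List (El A) → Set
Mem A x xs = mem A x xs ≡ true

Sub : (A : Ty) → List (El A) → List (El A) → Set
Sub A xs ys = sub A xs ys ≡ true

filterB : {X : Set} → (X → Bool) → List X → List X
filterB p []       = []
filterB p (x ∷ xs) = if p x then x ∷ filterB p xs else filterB p xs

dedup : (A : Ty) → List (El A) → List (El A)
dedup A []       = []
dedup A (x ∷ xs) = if mem A x xs then dedup A xs else x ∷ dedup A xs

Pp : ℕ → Ty → Ty
Pp zero    A = A
Pp (suc m) A = P (Pp m A)

Tp : ℕ → Ty → Ty
Tp zero    A = A
Tp (suc m) A = T (Tp m A)

PF : (A B : Ty) → (El A → El B) → El (P A) → El (P B)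
PF A B f = map f

-- T f : the semigroup homomorphism extending f
TF : (A B : Ty) → (El A → El B) → El (T A) → El (T B)
TF A B f = map f

-- σ_Y : P_F Y → T Y,  {a₁,…,aₖ} ↦ a₁ + … + aₖ (distinct aⱼ)
σ : (A : Ty) → El (P A) → El (T A)
σ A xs = dedup A xs

σ^ : (A : Ty) (m : ℕ) → El (Pp (suc m) A) → El (Tp (suc m) A)
σ^ A zero    = σ A
σ^ A (suc m) = σ (Tp (suc m) A) ∘ PF (Pp (suc m) A) (Tp (suc m) A) (σ^ A m)

-- μ_Y : T² Y → T Y (evaluates +² as +)
μ : (A : Ty) → El (T (T A)) → El (T A)
μ A = concat

μ^ : (A : Ty) (m : ℕ) → El (Tp (suc m) A) → El (T A)
μ^ A zero    = id
μ^ A (suc m) = μ A ∘ TF (Tp (suc m) A) (T A) (μ^ A m)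

Complex : Ty → Set₁
Complex A = El (P A) → Set

IsSimplicialComplex : (A : Ty) → Complex A → Set
IsSimplicialComplex A C =
  Σ (List (El (P A))) λ bases →
    (bases ≢ []) ×
    (∀ i j → i ≢ j → ¬ Sub A (lookup bases i) (lookup bases j)) ×
    (∀ α → (C α → Any (λ β → Sub A α β) bases) ×
           (Any (λ β → Sub A α β) bases → C α))

IsBasis : (A : Ty) → Complex A → El (P A) → Set
IsBasis A C α = C α × (∀ γ → C γ → Sub A α γ → Sub A γ α)

restrict : (A : Ty) → List (El (P A)) → El (P A) → List (El (P A))
restrict A B β = filterB (λ γ → sub A γ β) B

IsBuildingSetPow : (A : Ty) → El (P A) → List (El (P A)) → Set
IsBuildingSetPow A α B =
  (∀ γ → Mem (P A) γ B → (γ ≢ []) × Sub A γ α) ×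
  (∀ β γ → Mem (P A) β B → Mem (P A) γ B →
     (∃[ x ] (Mem A x β × Mem A x γ)) → Mem (P A) (β ++ γ) B) ×
  (∀ a → Mem A a α → Mem (P A) (a ∷ []) B)

IsBuildingSet : (A : Ty) → Complex A → List (El (P A)) → Set
IsBuildingSet A C B =
  All C B × (∀ α → IsBasis A C α → IsBuildingSetPow A α (restrict A B α))

-- N-antichain, given as a list of t ≥ 2 members of N at pairwise
-- ⊆-incomparable positions (hence a set of t distinct members)
IsAntichain : (A : Ty) → El (P (P A)) → List (El (P A)) → Set
IsAntichain A N βs =
  (2 ≤ length βs) ×
  All (λ β → Mem (P A) β N) βs ×
  (∀ i j → i ≢ j → ¬ Sub A (lookup βs i) (lookup βs j))

IsNested : (A : Ty) → Complex A → List (El (P A)) → El (P (P A)) → Set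
IsNested A C B N =
  (∀ β → Mem (P A) β N → Mem (P A) β B) ×
  (∀ βs → IsAntichain A N βs → C (concat βs) × ¬ Mem (P A) (concat βs) B)

Ñ : (A : Ty) → Complex A → List (El (P A)) → Complex (P A)
Ñ A C B N = IsNested A C B N

X : ℕ → Ty
X k = base k

data Builds (k : ℕ) : ℕ → Set where
  bld₀ : El (P (P (X k))) → Builds k zero
  _▷_  : {n : ℕ} → Builds k n → El (P (P (Pp (suc n) (X k)))) → Builds k (suc n)

Ñs : {k n : ℕ} → Complex (X k) → Builds k n → Complex (Pp (suc n) (X k))
Ñs {k} C (bld₀ B)         = Ñ (X k) C B
Ñs {k} C (_▷_ {n} bs B)   = Ñ (Pp (suc n) (X k)) (Ñs C bs) B

ValidBuilds : {k n : ℕ} → Complex (X k) → Builds k n → Set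
ValidBuilds {k} C (bld₀ B)       = IsBuildingSet (X k) C B
ValidBuilds {k} C (_▷_ {n} bs B) =
  ValidBuilds C bs × IsBuildingSet (Pp (suc n) (X k)) (Ñs C bs) B

St : {k n : ℕ} → Complex (X k) → Builds k n → Complex (Tp (suc n) (X k))
St {k} {n} C bs α =
  ∃[ N ] (Ñs C bs N × Eq (P (Tp (suc n) (X k))) α (PF (Pp (suc n) (X k)) (Tp (suc n) (X k)) (σ^ (X k) n) N))

Ss : {k n : ℕ} → Complex (X k) → Builds k n → Complex (T (X k))
Ss {k} {n} C bs α =
  ∃[ β ] (St C bs β × Eq (P (T (X k))) α (PF (Tp (suc n) (X k)) (T (X k)) (μ^ (X k) n) β))

InUnion : (A : Ty) → Complex A → El A → Set
InUnion A C v = ∃[ α ] (C α × Mem A v α)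

Underlies : (A B : Ty) → (El A → El B) → Complex A → Complex B → Set
Underlies A B ψ C D =
  -- ψ is a well-defined function on the represented objects
  (∀ u v → Eq A u v → Eq B (ψ u) (ψ v)) ×
  -- its restriction to ⋃C is a bijection onto ⋃D
  (∀ v → InUnion A C v → InUnion B D (ψ v)) ×
  (∀ u v → InUnion A C u → InUnion A C v → Eq B (ψ u) (ψ v) → Eq A u v) ×
  (∀ w → InUnion B D w → ∃[ v ] (InUnion A C v × Eq B (ψ v) w)) ×
  (∀ α → All (InUnion A C) α → (C α → D (PF A B ψ α)) × (D (PF A B ψ α) → C α))

-- Write ψₙ = μⁿ ∘ σⁿ⁺¹, so that ψₙ₊₁ sends a set N to the formal sum of the ψₙ(β), β ∈ N.
-- By induction over the levels, starting from C where the map is the identity, the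
-- additive extension of ψₙ to formal sums is injective on faces of Ñ(C,B₀,…,Bₙ). The
-- inductive step reduces, through the multiset Σ_{β∈N} β, to the fact that a nested set N
-- is determined by this multiset: a maximal member of N contains every member of B lying
-- in ⋃N and meeting it (otherwise the maxima meeting that member form an antichain whose
-- union lies in B by (B1) inside a basis), so two nested sets with the same multiset share
-- their maxima, which can be peeled off. On singletons this makes ψₙ injective on vertices,
-- and the faces of Ss are by definition the ψₙ-images of faces.

module Submission where

open import Defs
open import Data.Nat using (ℕ; zero; suc; _≤_; _+_; _≡ᵇ_; s≤s; z≤n)
open import Data.Nat.Properties using (≡ᵇ⇒≡; ≡⇒≡ᵇ; +-comm; +-assoc; +-cancelˡ-≡; suc-injective)
open import Data.Fin using () renaming (zero to fzero; suc to fsuc)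
import Data.Fin.Properties as Fin
open import Data.Bool using (Bool; true; false; _∧_; if_then_else_)
open import Data.Bool.Properties using (T-≡)
open import Data.List.Base using (List; []; _∷_; _++_; map; concat; length; lookup; [_])
open import Data.Bool.ListAction using (any)
open import Data.List.Properties
  using (map-∘; map-++; map-cong; concat-map; concat-concat; concat-map-[_]; ++-identityʳ)
open import Data.List.Relation.Unary.Any as Any using (Any; here; there)
import Data.List.Relation.Unary.Any.Properties as Any
open import Data.List.Relation.Unary.All as All using (All; []; _∷_)
open import Data.List.Membership.Propositional using (_∈_; find)
import Data.Product
open import Data.Product using (Σ; _×_; _,_; proj₁; proj₂; ∃-syntax)
open import Data.Sum using (_⊎_; inj₁; inj₂; [_,_]′)
import Data.Sum
open import Data.Empty using (⊥-elim)
open import Data.Unit using (⊤)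
open import Function using (_∘_; id; Equivalence)
open import Relation.Binary.PropositionalEquality
  using (_≡_; _≢_; refl; sym; trans; cong; cong₂; subst; subst₂; module ≡-Reasoning)
open import Relation.Nullary using (¬_; yes; no)
open import Relation.Nullary.Decidable using (¬¬-excluded-middle)

true≢false : true ≢ false
true≢false ()

∧-trueˡ : ∀ {a b} → a ∧ b ≡ true → a ≡ true
∧-trueˡ {true} _ = refl

∧-trueʳ : ∀ {a b} → a ∧ b ≡ true → b ≡ true
∧-trueʳ {true} p = p

∧-true : ∀ {a b} → a ≡ true → b ≡ true → a ∧ b ≡ true
∧-true refl refl = refl

≡-true-unique : ∀ {a b} → (a ≡ true → b ≡ true) → (b ≡ true → a ≡ true) → a ≡ b
≡-true-unique {true}          f g = sym (f refl)
≡-true-unique {false} {false} f g = refl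
≡-true-unique {false} {true}  f g = g refl

≡ᵇ-true⇒≡ : ∀ m n → (m ≡ᵇ n) ≡ true → m ≡ n
≡ᵇ-true⇒≡ m n h = ≡ᵇ⇒≡ m n (Equivalence.from T-≡ h)

≡⇒≡ᵇ-true : ∀ m n → m ≡ n → (m ≡ᵇ n) ≡ true
≡⇒≡ᵇ-true m n h = Equivalence.to T-≡ (≡⇒≡ᵇ m n h)

allB-true⁻ : {Z : Set} (p : Z → Bool) (l : List Z) → allB p l ≡ true → All (λ z → p z ≡ true) l
allB-true⁻ p []      _ = []
allB-true⁻ p (x ∷ l) h = ∧-trueˡ {p x} h ∷ allB-true⁻ p l (∧-trueʳ {p x} h)

allB-true⁺ : {Z : Set} (p : Z → Bool) (l : List Z) → (∀ z → p z ≡ true) → allB p l ≡ true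
allB-true⁺ p []      f = refl
allB-true⁺ p (x ∷ l) f = ∧-true (f x) (allB-true⁺ p l f)

allB-map : {Y Z : Set} (p : Z → Bool) (f : Y → Z) (l : List Y) → allB p (map f l) ≡ allB (p ∘ f) l
allB-map p f []      = refl
allB-map p f (x ∷ l) = cong (p (f x) ∧_) (allB-map p f l)

allB-cong : {Z : Set} {p q : Z → Bool} (l : List Z) → (∀ z → p z ≡ q z) → allB p l ≡ allB q l
allB-cong []      h = refl
allB-cong (x ∷ l) h = cong₂ _∧_ (h x) (allB-cong l h)

record EqIsEquivalence (A : Ty) : Set where
  field
    ≈-refl  : ∀ x → Eq A x x
    ≈-sym   : ∀ x y → Eq A x y → Eq A y x
    ≈-trans : ∀ x y z → Eq A x y → Eq A y z → Eq A x z

module Membership (A : Ty) (E : EqIsEquivalence A) where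
  open EqIsEquivalence E

  infix 4 _⊆_
  _⊆_ : List (El A) → List (El A) → Set
  xs ⊆ ys = ∀ x → Mem A x xs → Mem A x ys

  eq-respˡ-≈ : ∀ {x y} z → Eq A x y → eq A x z ≡ eq A y z
  eq-respˡ-≈ {x} {y} z e =
    ≡-true-unique (≈-trans y x z (≈-sym x y e)) (≈-trans x y z e)

  eq-respʳ-≈ : ∀ {y y′} z → Eq A y y′ → eq A z y ≡ eq A z y′
  eq-respʳ-≈ {y} {y′} z e =
    ≡-true-unique (λ h → ≈-trans z y y′ h e) (λ h → ≈-trans z y′ y h (≈-sym y y′ e))

  mem-resp-≈ : ∀ {x y} zs → Eq A x y → mem A x zs ≡ mem A y zs
  mem-resp-≈     []       e = refl
  mem-resp-≈ {y = y} (z ∷ zs) e rewrite eq-respˡ-≈ z e =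
    cong (if eq A y z then true else_) (mem-resp-≈ zs e)

  count-resp-≈ : ∀ {x y} zs → Eq A x y → count A x zs ≡ count A y zs
  count-resp-≈     []       e = refl
  count-resp-≈ {y = y} (z ∷ zs) e rewrite eq-respˡ-≈ z e =
    cong (λ c → if eq A y z then suc c else c) (count-resp-≈ zs e)

  mem⇒Any : ∀ {x} zs → Mem A x zs → Any (Eq A x) zs
  mem⇒Any {x} (z ∷ zs) h with eq A x z in exz
  ... | true  = here exz
  ... | false = there (mem⇒Any zs h)

  Any⇒mem : ∀ {x} zs → Any (Eq A x) zs → Mem A x zs
  Any⇒mem {x} (z ∷ zs) a with eq A x z in exz
  Any⇒mem {x} (z ∷ zs) a         | true  = refl
  Any⇒mem {x} (z ∷ zs) (here p)  | false = ⊥-elim (true≢false (trans (sym p) exz))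
  Any⇒mem {x} (z ∷ zs) (there a) | false = Any⇒mem zs a

  ∈⇒mem : ∀ {x} zs → x ∈ zs → Mem A x zs
  ∈⇒mem {x} zs x∈zs = Any⇒mem zs (Any.map (λ { refl → ≈-refl x }) x∈zs)

  mem-here : ∀ x zs → Mem A x (x ∷ zs)
  mem-here x zs = Any⇒mem (x ∷ zs) (here (≈-refl x))

  mem-there : ∀ x z zs → Mem A x zs → Mem A x (z ∷ zs)
  mem-there x z zs h = Any⇒mem (z ∷ zs) (there (mem⇒Any zs h))

  mem-≈ : ∀ {x y} zs → Eq A x y → Mem A y zs → Mem A x zs
  mem-≈ zs e h = trans (mem-resp-≈ zs e) h

  mem-∷⁻ : ∀ x y ys → Mem A x (y ∷ ys) → Eq A x y ⊎ Mem A x ys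
  mem-∷⁻ x y ys h with eq A x y
  ... | true  = inj₁ refl
  ... | false = inj₂ h

  sub⇒⊆ : ∀ xs ys → Sub A xs ys → xs ⊆ ys
  sub⇒⊆ (z ∷ xs) ys h x m with eq A x z in exz
  ... | true  = mem-≈ ys exz (∧-trueˡ {mem A z ys} h)
  ... | false = sub⇒⊆ xs ys (∧-trueʳ {mem A z ys} h) x m

  ⊆⇒sub : ∀ xs ys → xs ⊆ ys → Sub A xs ys
  ⊆⇒sub []       ys f = refl
  ⊆⇒sub (z ∷ xs) ys f = ∧-true (f z (mem-here z xs)) (⊆⇒sub xs ys (λ x m → f x (mem-there x z xs m)))

  ¬mem⇒count≡0 : ∀ {x} zs → mem A x zs ≡ false → count A x zs ≡ 0
  ¬mem⇒count≡0     []       _ = refl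
  ¬mem⇒count≡0 {x} (z ∷ zs) h with eq A x z
  ... | false = ¬mem⇒count≡0 zs h

  count≡suc⇒mem : ∀ {x} zs n → count A x zs ≡ suc n → Mem A x zs
  count≡suc⇒mem {x} zs n h with mem A x zs in em
  ... | true  = refl
  ... | false with () ← trans (sym h) (¬mem⇒count≡0 zs em)

  mem⇒count≡suc : ∀ {x} zs → Mem A x zs → ∃[ n ] count A x zs ≡ suc n
  mem⇒count≡suc {x} (z ∷ zs) h with eq A x z
  ... | true  = count A x zs , refl
  ... | false = mem⇒count≡suc zs h

  count-++ : ∀ x xs ys → count A x (xs ++ ys) ≡ count A x xs + count A x ys
  count-++ x []       ys = refl
  count-++ x (z ∷ xs) ys with eq A x z
  ... | true  = cong suc (count-++ x xs ys)
  ... | false = count-++ x xs ys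

  mem-++⁺ˡ : ∀ x xs ys → Mem A x xs → Mem A x (xs ++ ys)
  mem-++⁺ˡ x (z ∷ xs) ys h with eq A x z
  ... | true  = refl
  ... | false = mem-++⁺ˡ x xs ys h

  mem-++⁺ʳ : ∀ x xs ys → Mem A x ys → Mem A x (xs ++ ys)
  mem-++⁺ʳ x []       ys h = h
  mem-++⁺ʳ x (z ∷ xs) ys h with eq A x z
  ... | true  = refl
  ... | false = mem-++⁺ʳ x xs ys h

  mem-++⁻ : ∀ x xs ys → Mem A x (xs ++ ys) → Mem A x xs ⊎ Mem A x ys
  mem-++⁻ x []       ys h = inj₂ h
  mem-++⁻ x (z ∷ xs) ys h with eq A x z
  ... | true  = inj₁ refl
  ... | false = mem-++⁻ x xs ys h

  eqT⇒count≡ : ∀ xs ys → Eq (T A) xs ys → ∀ z → count A z xs ≡ count A z ys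
  eqT⇒count≡ xs ys h z with mem A z (xs ++ ys) in em
  ... | true with All.lookupAny (allB-true⁻ _ (xs ++ ys) h) (mem⇒Any (xs ++ ys) em)
  ...   | same , z≈w =
    trans (count-resp-≈ xs z≈w) (trans (≡ᵇ-true⇒≡ _ _ same) (sym (count-resp-≈ ys z≈w)))
  eqT⇒count≡ xs ys h z | false with mem A z xs in ex | mem A z ys in ey
  ... | true  | _     = ⊥-elim (true≢false (trans (sym (mem-++⁺ˡ z xs ys ex)) em))
  ... | false | true  = ⊥-elim (true≢false (trans (sym (mem-++⁺ʳ z xs ys ey)) em))
  ... | false | false = trans (¬mem⇒count≡0 xs ex) (sym (¬mem⇒count≡0 ys ey))

  count≡⇒eqT : ∀ xs ys → (∀ z → count A z xs ≡ count A z ys) → Eq (T A) xs ys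
  count≡⇒eqT xs ys f = allB-true⁺ _ (xs ++ ys) (λ z → ≡⇒≡ᵇ-true _ _ (f z))

  eqP⇒⊆ : ∀ xs ys → Eq (P A) xs ys → xs ⊆ ys
  eqP⇒⊆ xs ys h = sub⇒⊆ xs ys (∧-trueˡ {sub A xs ys} h)

  ⊆⇒eqP : ∀ xs ys → xs ⊆ ys → ys ⊆ xs → Eq (P A) xs ys
  ⊆⇒eqP xs ys f g = ∧-true (⊆⇒sub xs ys f) (⊆⇒sub ys xs g)

  eqP-sym : ∀ xs ys → Eq (P A) xs ys → Eq (P A) ys xs
  eqP-sym xs ys h = ∧-true (∧-trueʳ {sub A xs ys} h) (∧-trueˡ {sub A xs ys} h)

  eqP-isEquivalence : EqIsEquivalence (P A)
  eqP-isEquivalence = record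
    { ≈-refl  = λ xs → ⊆⇒eqP xs xs (λ _ m → m) (λ _ m → m)
    ; ≈-sym   = eqP-sym
    ; ≈-trans = λ xs ys zs p q → ⊆⇒eqP xs zs
        (λ x m → eqP⇒⊆ ys zs q x (eqP⇒⊆ xs ys p x m))
        (λ x m → eqP⇒⊆ ys xs (eqP-sym xs ys p) x (eqP⇒⊆ zs ys (eqP-sym ys zs q) x m)) }

  eqT-isEquivalence : EqIsEquivalence (T A)
  eqT-isEquivalence = record
    { ≈-refl  = λ xs → count≡⇒eqT xs xs (λ _ → refl)
    ; ≈-sym   = λ xs ys p → count≡⇒eqT ys xs (λ z → sym (eqT⇒count≡ xs ys p z))
    ; ≈-trans = λ xs ys zs p q → count≡⇒eqT xs zs
        (λ z → trans (eqT⇒count≡ xs ys p z) (eqT⇒count≡ ys zs q z)) }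

eq-isEquivalence : ∀ A → EqIsEquivalence A
eq-isEquivalence (base k) = record
  { ≈-refl  = λ x → ≡⇒eq x x refl
  ; ≈-sym   = λ x y h → ≡⇒eq y x (sym (eq⇒≡ x y h))
  ; ≈-trans = λ x y z h h′ → ≡⇒eq x z (trans (eq⇒≡ x y h) (eq⇒≡ y z h′)) }
  where
  eq⇒≡ : ∀ x y → Eq (base k) x y → x ≡ y
  eq⇒≡ x y h with x Fin.≟ y
  ... | yes p = p
  ≡⇒eq : ∀ x y → x ≡ y → Eq (base k) x y
  ≡⇒eq x y p with x Fin.≟ y
  ... | yes _ = refl
  ... | no ¬p = ⊥-elim (¬p p)
eq-isEquivalence (P A) = Membership.eqP-isEquivalence A (eq-isEquivalence A)
eq-isEquivalence (T A) = Membership.eqT-isEquivalence A (eq-isEquivalence A)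

module Lists (A : Ty) where
  open EqIsEquivalence (eq-isEquivalence A) public
  open Membership A (eq-isEquivalence A) public

  infix 4 _≋_
  _≋_ : List (El A) → List (El A) → Set
  xs ≋ ys = ∀ z → count A z xs ≡ count A z ys

  mem-dedup : ∀ x xs → mem A x (dedup A xs) ≡ mem A x xs
  mem-dedup x []       = refl
  mem-dedup x (y ∷ ys) with mem A y ys in ey
  ... | true with eq A x y in exy
  ...   | true  = trans (mem-dedup x ys) (trans (mem-resp-≈ ys exy) ey)
  ...   | false = mem-dedup x ys
  mem-dedup x (y ∷ ys) | false with eq A x y
  ...   | true  = refl
  ...   | false = mem-dedup x ys

  count-dedup-¬mem : ∀ x xs → mem A x xs ≡ false → count A x (dedup A xs) ≡ 0
  count-dedup-¬mem x xs h = ¬mem⇒count≡0 (dedup A xs) (trans (mem-dedup x xs) h)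

  count-dedup-mem : ∀ x xs → Mem A x xs → count A x (dedup A xs) ≡ 1
  count-dedup-mem x (y ∷ ys) h with mem A y ys in ey
  ... | true with eq A x y in exy
  ...   | true  = count-dedup-mem x ys (trans (mem-resp-≈ ys exy) ey)
  ...   | false = count-dedup-mem x ys h
  count-dedup-mem x (y ∷ ys) h | false with eq A x y in exy
  ...   | true  = cong suc (count-dedup-¬mem x ys (trans (mem-resp-≈ ys exy) ey))
  ...   | false = count-dedup-mem x ys h

  eq-dedup : ∀ u u′ → eq (T A) (dedup A u) (dedup A u′) ≡ eq (P A) u u′
  eq-dedup u u′ = ≡-true-unique
    (λ h → let c = eqT⇒count≡ (dedup A u) (dedup A u′) h in
           ⊆⇒eqP u u′ (λ x m → reflect u u′ x m (c x)) (λ x m → reflect u′ u x m (sym (c x))))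
    (λ h → count≡⇒eqT (dedup A u) (dedup A u′) (same-count h))
    where
    reflect : ∀ a b x → Mem A x a → count A x (dedup A a) ≡ count A x (dedup A b) → Mem A x b
    reflect a b x m c with mem A x b in eb
    ... | true  = refl
    ... | false with () ← trans (sym (count-dedup-mem x a m)) (trans c (count-dedup-¬mem x b eb))
    same-count : Eq (P A) u u′ → dedup A u ≋ dedup A u′
    same-count h z with mem A z u in e | mem A z u′ in e′
    ... | true  | true  = trans (count-dedup-mem z u e) (sym (count-dedup-mem z u′ e′))
    ... | false | false = trans (count-dedup-¬mem z u e) (sym (count-dedup-¬mem z u′ e′))
    ... | true  | false = ⊥-elim (true≢false (trans (sym (eqP⇒⊆ u u′ h z e)) e′))
    ... | false | true  = ⊥-elim (true≢false (trans (sym (eqP⇒⊆ u′ u (eqP-sym u u′ h) z e′)) e))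

  mem-lookup : ∀ l i → Mem A (lookup l i) l
  mem-lookup (y ∷ l) fzero    = mem-here y l
  mem-lookup (y ∷ l) (fsuc i) = mem-there _ y l (mem-lookup l i)

  mem-filter⁻ : ∀ p x l → Mem A x (filterB p l) → Mem A x l
  mem-filter⁻ p x (y ∷ l) h with p y
  ... | false = mem-there x y l (mem-filter⁻ p x l h)
  ... | true with mem-∷⁻ x y (filterB p l) h
  ...   | inj₁ e  = mem-≈ (y ∷ l) e (mem-here y l)
  ...   | inj₂ h′ = mem-there x y l (mem-filter⁻ p x l h′)

  mem-filter⁺ : ∀ p → (∀ x y → Eq A x y → p x ≡ true → p y ≡ true) →
                ∀ x l → Mem A x l → p x ≡ true → Mem A x (filterB p l)
  mem-filter⁺ p p-resp x (y ∷ l) h px with p y in py | mem-∷⁻ x y l h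
  ... | true  | inj₁ e  = mem-≈ (y ∷ filterB p l) e (mem-here y (filterB p l))
  ... | true  | inj₂ h′ = mem-there x y (filterB p l) (mem-filter⁺ p p-resp x l h′ px)
  ... | false | inj₁ e  with () ← trans (sym (p-resp x y e px)) py
  ... | false | inj₂ h′ = mem-filter⁺ p p-resp x l h′ px

  Distinct : List (El A) → Set
  Distinct []      = ⊤
  Distinct (y ∷ l) = mem A y l ≡ false × Distinct l

  dedup-distinct : ∀ l → Distinct (dedup A l)
  dedup-distinct []      = _
  dedup-distinct (y ∷ l) with mem A y l in e
  ... | true  = dedup-distinct l
  ... | false = trans (mem-dedup y l) e , dedup-distinct l

  filter-distinct : ∀ p l → Distinct l → Distinct (filterB p l)
  filter-distinct p []      d = d
  filter-distinct p (y ∷ l) (y∉l , d) with p y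
  ... | true  = y∉filter , filter-distinct p l d
    where
    y∉filter : mem A y (filterB p l) ≡ false
    y∉filter with mem A y (filterB p l) in e
    ... | false = refl
    ... | true  = ⊥-elim (true≢false (trans (sym (mem-filter⁻ p y l e)) y∉l))
  ... | false = filter-distinct p l d

  distinct-lookup : ∀ l → Distinct l → ∀ i j → i ≢ j → eq A (lookup l i) (lookup l j) ≡ false
  distinct-lookup (y ∷ l) d       fzero    fzero    i≢j = ⊥-elim (i≢j refl)
  distinct-lookup (y ∷ l) (y∉l , d) fzero    (fsuc j) i≢j with eq A y (lookup l j) in e
  ... | false = refl
  ... | true  = ⊥-elim (true≢false (trans (sym (mem-≈ l e (mem-lookup l j))) y∉l))
  distinct-lookup (y ∷ l) (y∉l , d) (fsuc i) fzero    i≢j with eq A (lookup l i) y in e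
  ... | false = refl
  ... | true  = ⊥-elim (true≢false (trans (sym (mem-≈ l (≈-sym _ y e) (mem-lookup l i))) y∉l))
  distinct-lookup (y ∷ l) (y∉l , d) (fsuc i) (fsuc j) i≢j = distinct-lookup l d i j (i≢j ∘ cong fsuc)

  remove : El A → List (El A) → List (El A)
  remove a []       = []
  remove a (y ∷ ys) = if eq A a y then ys else y ∷ remove a ys

  count-swap : ∀ z a y L → count A z (a ∷ y ∷ L) ≡ count A z (y ∷ a ∷ L)
  count-swap z a y L with eq A z a | eq A z y
  ... | true  | true  = refl
  ... | true  | false = refl
  ... | false | true  = refl
  ... | false | false = refl

  count-∷-cong : ∀ z y L L′ → count A z L ≡ count A z L′ → count A z (y ∷ L) ≡ count A z (y ∷ L′)
  count-∷-cong z y L L′ h =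
    trans (count-++ z [ y ] L) (trans (cong (count A z [ y ] +_) h) (sym (count-++ z [ y ] L′)))

  count-∷-cancel : ∀ z y L L′ → count A z (y ∷ L) ≡ count A z (y ∷ L′) → count A z L ≡ count A z L′
  count-∷-cancel z y L L′ h =
    +-cancelˡ-≡ (count A z [ y ]) _ _ (trans (sym (count-++ z [ y ] L)) (trans h (count-++ z [ y ] L′)))

  count-remove : ∀ a L → Mem A a L → ∀ z → count A z L ≡ count A z (a ∷ remove a L)
  count-remove a (y ∷ ys) h z with eq A a y in eay
  ... | true  rewrite eq-respʳ-≈ z (≈-sym a y eay) = refl
  ... | false = trans (count-∷-cong z y ys (a ∷ remove a ys) (count-remove a ys h z))
                      (count-swap z y a (remove a ys))

  mem-remove : ∀ a L z → Mem A z (remove a L) → Mem A z L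
  mem-remove a (y ∷ ys) z h with eq A a y
  ... | true  = mem-there z y ys h
  ... | false with eq A z y
  ...   | true  = refl
  ...   | false = mem-remove a ys z h

  length-remove : ∀ a L → Mem A a L → suc (length (remove a L)) ≡ length L
  length-remove a (y ∷ ys) h with eq A a y
  ... | true  = refl
  ... | false = cong suc (length-remove a ys h)

  count-here : ∀ y L → ∃[ n ] count A y (y ∷ L) ≡ suc n
  count-here y L = mem⇒count≡suc (y ∷ L) (mem-here y L)

module ConcatMap (A B : Ty) (f : El A → El (T B))
                 (f-resp : ∀ a a′ → Eq A a a′ → Lists._≋_ B (f a) (f a′)) where
  private
    module A = Lists A
    module B = Lists B

  count-concatMap-∷ : ∀ x l L →
    count B x (concat (map f (l ∷ L))) ≡ count B x (f l) + count B x (concat (map f L))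
  count-concatMap-∷ x l L = B.count-++ x (f l) (concat (map f L))

  count-concatMap-remove : ∀ a L → Mem A a L → ∀ x →
    count B x (concat (map f L)) ≡ count B x (f a) + count B x (concat (map f (A.remove a L)))
  count-concatMap-remove a (y ∷ ys) h x with eq A a y in eay
  ... | true  = trans (count-concatMap-∷ x y ys)
                      (cong (_+ count B x (concat (map f ys))) (f-resp y a (A.≈-sym a y eay) x))
  ... | false = begin
    count B x (concat (map f (y ∷ ys)))                   ≡⟨ count-concatMap-∷ x y ys ⟩
    cy + count B x (concat (map f ys))                     ≡⟨ cong (cy +_) (count-concatMap-remove a ys h x) ⟩
    cy + (ca + rest)                                       ≡⟨ sym (+-assoc cy ca rest) ⟩
    cy + ca + rest                                         ≡⟨ cong (_+ rest) (+-comm cy ca) ⟩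
    ca + cy + rest                                         ≡⟨ +-assoc ca cy rest ⟩
    ca + (cy + rest)                                       ≡⟨ cong (ca +_) (sym (count-concatMap-∷ x y (A.remove a ys))) ⟩
    ca + count B x (concat (map f (y ∷ A.remove a ys)))    ∎
    where
    open ≡-Reasoning
    ca cy rest : ℕ
    ca = count B x (f a)
    cy = count B x (f y)
    rest = count B x (concat (map f (A.remove a ys)))

  concatMap-resp-≋ : ∀ L L′ → L A.≋ L′ → concat (map f L) B.≋ concat (map f L′)
  concatMap-resp-≋ []       []        h x = refl
  concatMap-resp-≋ []       (y ∷ L′)  h x with A.count-here y L′
  ... | n , e with () ← trans (h y) e
  concatMap-resp-≋ (a ∷ L₁) L′ h x = begin
    count B x (concat (map f (a ∷ L₁)))                      ≡⟨ count-concatMap-∷ x a L₁ ⟩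
    count B x (f a) + count B x (concat (map f L₁))         ≡⟨ cong (count B x (f a) +_) (concatMap-resp-≋ L₁ R′ h₁ x) ⟩
    count B x (f a) + count B x (concat (map f R′))         ≡⟨ sym (count-concatMap-remove a L′ a∈L′ x) ⟩
    count B x (concat (map f L′))                            ∎
    where
    open ≡-Reasoning
    R′ : List (El A)
    R′ = A.remove a L′
    a∈L′ : Mem A a L′
    a∈L′ = let n , e = A.count-here a L₁ in A.count≡suc⇒mem L′ n (trans (sym (h a)) e)
    h₁ : L₁ A.≋ R′
    h₁ z = A.count-∷-cancel z a L₁ R′ (trans (h z) (A.count-remove a L′ a∈L′ z))

module Embedding (A B : Ty) (f : El A → El B) (eq-f : ∀ a a′ → eq B (f a) (f a′) ≡ eq A a a′) where

  mem-map : ∀ a xs → mem B (f a) (map f xs) ≡ mem A a xs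
  mem-map a []       = refl
  mem-map a (x ∷ xs) rewrite eq-f a x = cong (if eq A a x then true else_) (mem-map a xs)

  count-map : ∀ a xs → count B (f a) (map f xs) ≡ count A a xs
  count-map a []       = refl
  count-map a (x ∷ xs) rewrite eq-f a x = cong (λ c → if eq A a x then suc c else c) (count-map a xs)

  dedup-map : ∀ xs → dedup B (map f xs) ≡ map f (dedup A xs)
  dedup-map []       = refl
  dedup-map (x ∷ xs) rewrite mem-map x xs with mem A x xs
  ... | true  = dedup-map xs
  ... | false = cong (f x ∷_) (dedup-map xs)

  eqT-map : ∀ xs ys → eq (T B) (map f xs) (map f ys) ≡ eq (T A) xs ys
  eqT-map xs ys = begin
    allB (λ z → count B z (map f xs) ≡ᵇ count B z (map f ys)) (map f xs ++ map f ys)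
      ≡⟨ cong (allB _) (sym (map-++ f xs ys)) ⟩
    allB (λ z → count B z (map f xs) ≡ᵇ count B z (map f ys)) (map f (xs ++ ys))
      ≡⟨ allB-map _ f (xs ++ ys) ⟩
    allB (λ z → count B (f z) (map f xs) ≡ᵇ count B (f z) (map f ys)) (xs ++ ys)
      ≡⟨ allB-cong (xs ++ ys) (λ z → cong₂ _≡ᵇ_ (count-map z xs) (count-map z ys)) ⟩
    allB (λ z → count A z xs ≡ᵇ count A z ys) (xs ++ ys)
      ∎
    where open ≡-Reasoning

eq-σ^ : ∀ A n u u′ → eq (Tp (suc n) A) (σ^ A n u) (σ^ A n u′) ≡ eq (Pp (suc n) A) u u′
eq-σ^ A zero    u u′ = Lists.eq-dedup A u u′
eq-σ^ A (suc n) u u′ = begin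
  eq (T (Tp (suc n) A)) (dedup (Tp (suc n) A) (map (σ^ A n) u)) (dedup (Tp (suc n) A) (map (σ^ A n) u′))
    ≡⟨ cong₂ (eq (T (Tp (suc n) A))) (E.dedup-map u) (E.dedup-map u′) ⟩
  eq (T (Tp (suc n) A)) (map (σ^ A n) (dedup (Pp (suc n) A) u)) (map (σ^ A n) (dedup (Pp (suc n) A) u′))
    ≡⟨ E.eqT-map (dedup (Pp (suc n) A) u) (dedup (Pp (suc n) A) u′) ⟩
  eq (T (Pp (suc n) A)) (dedup (Pp (suc n) A) u) (dedup (Pp (suc n) A) u′)
    ≡⟨ Lists.eq-dedup (Pp (suc n) A) u u′ ⟩
  eq (P (Pp (suc n) A)) u u′
    ∎
  where
  open ≡-Reasoning
  module E = Embedding (Pp (suc n) A) (Tp (suc n) A) (σ^ A n) (eq-σ^ A n)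

μ^-resp-≈ : ∀ A n a a′ → Eq (Tp (suc n) A) a a′ → Lists._≋_ A (μ^ A n a) (μ^ A n a′)
μ^-resp-≈ A zero    a a′ e = Lists.eqT⇒count≡ A a a′ e
μ^-resp-≈ A (suc n) a a′ e =
  ConcatMap.concatMap-resp-≋ (Tp (suc n) A) A (μ^ A n) (μ^-resp-≈ A n) a a′
    (Lists.eqT⇒count≡ (Tp (suc n) A) a a′ e)

flatten : ∀ A n → El (Pp (suc n) A) → El (T A)
flatten A n = μ^ A n ∘ σ^ A n

flatten-suc : ∀ A n v → flatten A (suc n) v ≡ concat (map (flatten A n) (dedup (Pp (suc n) A) v))
flatten-suc A n v = begin
  concat (map (μ^ A n) (dedup (Tp (suc n) A) (map (σ^ A n) v)))
    ≡⟨ cong (concat ∘ map (μ^ A n)) (E.dedup-map v) ⟩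
  concat (map (μ^ A n) (map (σ^ A n) (dedup (Pp (suc n) A) v)))
    ≡⟨ cong concat (sym (map-∘ (dedup (Pp (suc n) A) v))) ⟩
  concat (map (flatten A n) (dedup (Pp (suc n) A) v))
    ∎
  where
  open ≡-Reasoning
  module E = Embedding (Pp (suc n) A) (Tp (suc n) A) (σ^ A n) (eq-σ^ A n)

flatten-resp-≈ : ∀ A n u v → Eq (Pp (suc n) A) u v → Eq (T A) (flatten A n u) (flatten A n v)
flatten-resp-≈ A n u v e = Lists.count≡⇒eqT A (flatten A n u) (flatten A n v)
  (μ^-resp-≈ A n (σ^ A n u) (σ^ A n v) (trans (eq-σ^ A n u v) e))

mem-map⁺ : ∀ A B (f : El A → El B) → (∀ a a′ → Eq A a a′ → Eq B (f a) (f a′)) →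
           ∀ a l → Mem A a l → Mem B (f a) (map f l)
mem-map⁺ A B f f-resp a l h = Lists.Any⇒mem B (map f l) (Any.map⁺ (Any.map (f-resp a _) (Lists.mem⇒Any A l h)))

mem-map⁻ : ∀ A B (f : El A → El B) y l → Mem B y (map f l) → ∃[ a ] (a ∈ l × Eq B y (f a))
mem-map⁻ A B f y l h = find (Any.map⁻ (Lists.mem⇒Any B (map f l) h))

module Image (A B : Ty) (f : El A → El B) (f-resp : ∀ a a′ → Eq A a a′ → Eq B (f a) (f a′)) where
  private
    module A = Lists A
    module B = Lists B

  image-resp-≈ : ∀ α α′ → Eq (P A) α α′ → Eq (P B) (map f α) (map f α′)
  image-resp-≈ α α′ e = B.⊆⇒eqP (map f α) (map f α′) (⊆-image α α′ (A.eqP⇒⊆ α α′ e))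
                                                     (⊆-image α′ α (A.eqP⇒⊆ α′ α (A.eqP-sym α α′ e)))
    where
    ⊆-image : ∀ α α′ → α A.⊆ α′ → map f α B.⊆ map f α′
    ⊆-image α α′ α⊆α′ y h with mem-map⁻ A B f y α h
    ... | a , a∈α , y≈fa = B.mem-≈ (map f α′) y≈fa (mem-map⁺ A B f f-resp a α′ (α⊆α′ a (A.∈⇒mem α a∈α)))

  image-injective : (U : El A → Set) → (∀ u u′ → U u → U u′ → Eq B (f u) (f u′) → Eq A u u′) →
    ∀ α α′ → (∀ a → Mem A a α → U a) → (∀ a → Mem A a α′ → U a) →
    Eq (P B) (map f α) (map f α′) → Eq (P A) α α′
  image-injective U f-inj α α′ U-α U-α′ e =
    A.⊆⇒eqP α α′ (⊆-preimage α α′ U-α U-α′ e) (⊆-preimage α′ α U-α′ U-α (B.eqP-sym (map f α) (map f α′) e))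
    where
    ⊆-preimage : ∀ α α′ → (∀ a → Mem A a α → U a) → (∀ a → Mem A a α′ → U a) →
                 Eq (P B) (map f α) (map f α′) → α A.⊆ α′
    ⊆-preimage α α′ U-α U-α′ e a a∈α
      with mem-map⁻ A B f (f a) α′ (B.eqP⇒⊆ (map f α) (map f α′) e (f a) (mem-map⁺ A B f f-resp a α a∈α))
    ... | a′ , a′∈α′ , fa≈fa′ =
      A.mem-≈ α′ (f-inj a a′ (U-α a a∈α) (U-α′ a′ a′∈α′′) fa≈fa′) a′∈α′′
      where
      a′∈α′′ : Mem A a′ α′
      a′∈α′′ = A.∈⇒mem α′ a′∈α′

∈-filter⁺ : {Z : Set} (p : Z → Bool) {x : Z} {l : List Z} → x ∈ l → p x ≡ true → x ∈ filterB p l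
∈-filter⁺ p {l = y ∷ l} (here refl) px rewrite px = here refl
∈-filter⁺ p {l = y ∷ l} (there x∈l) px with p y
... | true  = there (∈-filter⁺ p x∈l px)
... | false = ∈-filter⁺ p x∈l px

∈-filter⁻ : {Z : Set} (p : Z → Bool) {x : Z} (l : List Z) → x ∈ filterB p l → x ∈ l × p x ≡ true
∈-filter⁻ p (y ∷ l) x∈ with p y in py
∈-filter⁻ p (y ∷ l) (here refl) | true  = here refl , py
∈-filter⁻ p (y ∷ l) (there x∈)  | true  = Data.Product.map₁ there (∈-filter⁻ p l x∈)
∈-filter⁻ p (y ∷ l) x∈          | false = Data.Product.map₁ there (∈-filter⁻ p l x∈)

distinct-members⇒2≤length : {Z : Set} {d e : Z} {l : List Z} → d ∈ l → e ∈ l → d ≢ e → 2 ≤ length l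
distinct-members⇒2≤length {l = _ ∷ []}    (here refl) (here refl) d≢e = ⊥-elim (d≢e refl)
distinct-members⇒2≤length {l = _ ∷ _ ∷ _} _           _           _   = s≤s (s≤s z≤n)

concat-map-concat-map : {U V W : Set} (w : V → List W) (d : U → List V) (L : List U) →
  concat (map (concat ∘ map w ∘ d) L) ≡ concat (map w (concat (map d L)))
concat-map-concat-map w d L = begin
  concat (map (concat ∘ map w ∘ d) L)          ≡⟨ cong concat (map-∘ L) ⟩
  concat (map concat (map (map w ∘ d) L))      ≡⟨ concat-concat (map (map w ∘ d) L) ⟩
  concat (concat (map (map w ∘ d) L))          ≡⟨ cong (concat ∘ concat) (map-∘ L) ⟩
  concat (concat (map (map w) (map d L)))      ≡⟨ cong concat (concat-map (map d L)) ⟩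
  concat (map w (concat (map d L)))            ∎
  where open ≡-Reasoning

-- Families of sets: maxima, antichains, unions

module Families (A : Ty) where
  private
    module A = Lists A
    module PA = Lists (P A)

  sub-refl : ∀ a → Sub A a a
  sub-refl a = A.⊆⇒sub a a (λ _ m → m)

  sub-trans : ∀ a b c → Sub A a b → Sub A b c → Sub A a c
  sub-trans a b c p q = A.⊆⇒sub a c (λ x m → A.sub⇒⊆ b c q x (A.sub⇒⊆ a b p x m))

  eqP⇒sub : ∀ a b → Eq (P A) a b → Sub A a b
  eqP⇒sub a b e = ∧-trueˡ {sub A a b} e

  sub-antisym : ∀ a b → Sub A a b → Sub A b a → Eq (P A) a b
  sub-antisym a b p q = ∧-true p q

  Maximal : List (El (P A)) → El (P A) → Set
  Maximal N m = ∀ δ → Mem (P A) δ N → Sub A m δ → Sub A δ m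

  maximal-resp-≈ : ∀ N m m′ → Eq (P A) m m′ → Maximal N m → Maximal N m′
  maximal-resp-≈ N m m′ e mx δ mδ s =
    sub-trans δ m m′ (mx δ mδ (sub-trans m m′ δ (eqP⇒sub m m′ e) s)) (eqP⇒sub m m′ e)

  -- Scanning l once, moving up whenever a superset appears, ends at a set that no
  -- member of l strictly contains: a member skipped earlier was no superset of a
  -- smaller candidate.
  climb : ∀ m l → Σ (El (P A)) λ m′ →
    Sub A m m′ × (Eq (P A) m′ m ⊎ Mem (P A) m′ l) × Maximal l m′
  climb m []      = m , sub-refl m , inj₁ (PA.≈-refl m) , λ δ ()
  climb m (δ ∷ l) with sub A m δ in m⊆δ
  ... | true  = let m′ , δ⊆m′ , src , mx = climb δ l in
    m′ , sub-trans m δ m′ m⊆δ δ⊆m′ , inj₂ (from-δ src) , max-∷ δ⊆m′ mx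
    where
    from-δ : ∀ {m′} → Eq (P A) m′ δ ⊎ Mem (P A) m′ l → Mem (P A) m′ (δ ∷ l)
    from-δ {m′} (inj₁ e) = PA.mem-≈ (δ ∷ l) e (PA.mem-here δ l)
    from-δ {m′} (inj₂ h) = PA.mem-there m′ δ l h
    max-∷ : ∀ {m′} → Sub A δ m′ → Maximal l m′ → Maximal (δ ∷ l) m′
    max-∷ {m′} δ⊆m′ mx δ′ h s with PA.mem-∷⁻ δ′ δ l h
    ... | inj₁ e  = sub-trans δ′ δ m′ (eqP⇒sub δ′ δ e) δ⊆m′
    ... | inj₂ h′ = mx δ′ h′ s
  ... | false = let m′ , m⊆m′ , src , mx = climb m l in
    m′ , m⊆m′ , Data.Sum.map₂ (PA.mem-there m′ δ l) src , max-∷ m⊆m′ mx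
    where
    max-∷ : ∀ {m′} → Sub A m m′ → Maximal l m′ → Maximal (δ ∷ l) m′
    max-∷ {m′} m⊆m′ mx δ′ h s with PA.mem-∷⁻ δ′ δ l h
    ... | inj₁ e  with () ← trans (sym (sub-trans m m′ δ m⊆m′ (sub-trans m′ δ′ δ s (eqP⇒sub δ′ δ e)))) m⊆δ
    ... | inj₂ h′ = mx δ′ h′ s

  top : List (El (P A)) → El (P A) → El (P A)
  top N β = proj₁ (climb β N)

  top-spec : ∀ N β → Mem (P A) β N → Sub A β (top N β) × Mem (P A) (top N β) N × Maximal N (top N β)
  top-spec N β β∈N with climb β N
  ... | m′ , β⊆m′ , inj₁ e  , mx = β⊆m′ , PA.mem-≈ N e β∈N , mx
  ... | m′ , β⊆m′ , inj₂ h  , mx = β⊆m′ , h , mx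

  maxima : List (El (P A)) → List (El (P A))
  maxima N = dedup (P A) (map (top N) N)

  maxima⁻ : ∀ N m → Mem (P A) m (maxima N) → Mem (P A) m N × Maximal N m
  maxima⁻ N m h with mem-map⁻ (P A) (P A) (top N) m N (trans (sym (PA.mem-dedup m (map (top N) N))) h)
  ... | β , β∈N , e with top-spec N β (PA.∈⇒mem N β∈N)
  ...   | _ , t∈N , mx = PA.mem-≈ N e t∈N , maximal-resp-≈ N (top N β) m (PA.≈-sym m (top N β) e) mx

  maxima⁺ : ∀ N m → Mem (P A) m N → Maximal N m → Mem (P A) m (maxima N)
  maxima⁺ N m m∈N mx with find (PA.mem⇒Any N m∈N)
  ... | m₀ , m₀∈N , m≈m₀ with top-spec N m₀ (PA.∈⇒mem N m₀∈N)
  ...   | m₀⊆t , t∈N , _ = trans (PA.mem-dedup m (map (top N) N)) (PA.mem-≈ (map (top N) N) m≈t t∈map)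
    where
    m⊆t : Sub A m (top N m₀)
    m⊆t = sub-trans m m₀ (top N m₀) (eqP⇒sub m m₀ m≈m₀) m₀⊆t
    m≈t : Eq (P A) m (top N m₀)
    m≈t = sub-antisym m (top N m₀) m⊆t (mx (top N m₀) t∈N m⊆t)
    t∈map : Mem (P A) (top N m₀) (map (top N) N)
    t∈map = PA.∈⇒mem (map (top N) N) (Any.map⁺ (Any.map (cong (top N)) m₀∈N))

  maxima-cover : ∀ N β → Mem (P A) β N → ∃[ m ] (Mem (P A) m (maxima N) × Sub A β m)
  maxima-cover N β β∈N with top-spec N β β∈N
  ... | β⊆t , t∈N , mx = top N β , maxima⁺ N (top N β) t∈N mx , β⊆t

  antichain-of-maxima : ∀ N G → PA.Distinct G → (∀ g → Mem (P A) g G → Mem (P A) g N × Maximal N g) →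
                        2 ≤ length G → IsAntichain A N G
  antichain-of-maxima N G d G-max len =
    len , All.tabulate (λ {g} g∈G → proj₁ (G-max g (PA.∈⇒mem G g∈G))) , incomparable
    where
    incomparable : ∀ i j → i ≢ j → ¬ Sub A (lookup G i) (lookup G j)
    incomparable i j i≢j s = true≢false (trans (sym a≈b) (PA.distinct-lookup G d i j i≢j))
      where
      a b : El (P A)
      a = lookup G i
      b = lookup G j
      a≈b : Eq (P A) a b
      a≈b = sub-antisym a b s (proj₂ (G-max a (PA.mem-lookup G i)) b (proj₁ (G-max b (PA.mem-lookup G j))) s)

  mem-concat⁻ : ∀ x L → Mem A x (concat L) → Any (Mem A x) L
  mem-concat⁻ x (β ∷ L) h with A.mem-++⁻ x β (concat L) h
  ... | inj₁ p = here p
  ... | inj₂ p = there (mem-concat⁻ x L p)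

  mem-concat⁺ : ∀ x L → Any (Mem A x) L → Mem A x (concat L)
  mem-concat⁺ x (β ∷ L) (here p)  = A.mem-++⁺ˡ x β (concat L) p
  mem-concat⁺ x (β ∷ L) (there a) = A.mem-++⁺ʳ x β (concat L) (mem-concat⁺ x L a)

  member⊆concat : ∀ β L → Mem (P A) β L → β A.⊆ concat L
  member⊆concat β L β∈L x x∈β =
    mem-concat⁺ x L (Any.map (λ {z} e → A.eqP⇒⊆ β z e x x∈β) (PA.mem⇒Any L β∈L))

  ¬sub⇒witness : ∀ a b → sub A a b ≡ false → ∃[ y ] (Mem A y a × mem A y b ≡ false)
  ¬sub⇒witness (z ∷ a) b h with mem A z b in e
  ... | false = z , A.mem-here z a , e
  ... | true  = let y , y∈a , y∉b = ¬sub⇒witness a b h in y , A.mem-there y z a y∈a , y∉b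

  ++-rotate-≈ : ∀ a b c → Eq (P A) (a ++ (b ++ c)) ((a ++ c) ++ b)
  ++-rotate-≈ a b c = A.⊆⇒eqP (a ++ (b ++ c)) ((a ++ c) ++ b) to from
    where
    to : (a ++ (b ++ c)) A.⊆ ((a ++ c) ++ b)
    to x h with A.mem-++⁻ x a (b ++ c) h
    ... | inj₁ p = A.mem-++⁺ˡ x (a ++ c) b (A.mem-++⁺ˡ x a c p)
    ... | inj₂ p with A.mem-++⁻ x b c p
    ...   | inj₁ q = A.mem-++⁺ʳ x (a ++ c) b q
    ...   | inj₂ q = A.mem-++⁺ˡ x (a ++ c) b (A.mem-++⁺ʳ x a c q)
    from : ((a ++ c) ++ b) A.⊆ (a ++ (b ++ c))
    from x h with A.mem-++⁻ x (a ++ c) b h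
    ... | inj₂ p = A.mem-++⁺ʳ x a (b ++ c) (A.mem-++⁺ˡ x b c p)
    ... | inj₁ p with A.mem-++⁻ x a c p
    ...   | inj₁ q = A.mem-++⁺ˡ x a (b ++ c) q
    ...   | inj₂ q = A.mem-++⁺ʳ x a (b ++ c) (A.mem-++⁺ʳ x b c q)

  ++-absorbˡ-≈ : ∀ a b → Sub A a b → Eq (P A) b (a ++ b)
  ++-absorbˡ-≈ a b a⊆b = A.⊆⇒eqP b (a ++ b) (λ x → A.mem-++⁺ʳ x a b)
    (λ x h → [ A.sub⇒⊆ a b a⊆b x , id ]′ (A.mem-++⁻ x a b h))

  concat-maxima-≈ : ∀ N → Eq (P A) (concat N) (concat (maxima N))
  concat-maxima-≈ N = A.⊆⇒eqP (concat N) (concat (maxima N)) to from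
    where
    to : concat N A.⊆ concat (maxima N)
    to x h with find (mem-concat⁻ x N h)
    ... | β , β∈N , x∈β with maxima-cover N β (PA.∈⇒mem N β∈N)
    ...   | m , m∈M , β⊆m = member⊆concat m (maxima N) m∈M x (A.sub⇒⊆ β m β⊆m x x∈β)
    from : concat (maxima N) A.⊆ concat N
    from x h with find (mem-concat⁻ x (maxima N) h)
    ... | m , m∈M , x∈m = member⊆concat m N (proj₁ (maxima⁻ N m (PA.∈⇒mem (maxima N) m∈M))) x x∈m

  Meets : El (P A) → El (P A) → Set
  Meets γ g = ∃[ x ] (Mem A x γ × Mem A x g)

  meets : El (P A) → El (P A) → Bool
  meets γ g = any (λ z → mem A z g) γ

  meets⁺ : ∀ γ g → Meets γ g → meets γ g ≡ true
  meets⁺ (z ∷ γ) g (x , x∈zγ , x∈g) with mem A z g in z∈g | A.mem-∷⁻ x z γ x∈zγ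
  ... | true  | _        = refl
  ... | false | inj₁ x≈z = ⊥-elim (true≢false (trans (sym (A.mem-≈ g (A.≈-sym x z x≈z) x∈g)) z∈g))
  ... | false | inj₂ x∈γ = meets⁺ γ g (x , x∈γ , x∈g)

  meets⁻ : ∀ γ g → meets γ g ≡ true → Meets γ g
  meets⁻ (z ∷ γ) g h with mem A z g in z∈g
  ... | true  = z , A.mem-here z γ , z∈g
  ... | false = let x , x∈γ , x∈g = meets⁻ γ g h in x , A.mem-there x z γ x∈γ , x∈g

  building-++-meeting : ∀ {α} B′ → IsBuildingSetPow A α B′ → ∀ γ Gs → Mem (P A) γ B′ →
    All (λ g → Mem (P A) g B′ × Meets γ g) Gs → Mem (P A) (γ ++ concat Gs) B′
  building-++-meeting B′ bs γ []       γ∈B′ []                rewrite ++-identityʳ γ = γ∈B′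
  building-++-meeting B′ bs γ (g ∷ Gs) γ∈B′ ((g∈B′ , x , x∈γ , x∈g) ∷ rest) =
    PA.mem-≈ B′ (++-rotate-≈ γ g (concat Gs))
      (proj₁ (proj₂ bs) (γ ++ concat Gs) g (building-++-meeting B′ bs γ Gs γ∈B′ rest) g∈B′
        (x , A.mem-++⁺ˡ x γ (concat Gs) x∈γ , x∈g))

record ComplexLaws (A : Ty) (D : Complex A) : Set where
  field
    face-resp-≈   : ∀ α α′ → Eq (P A) α α′ → D α → D α′
    face-downward : ∀ α β → Sub A α β → D β → D α
    face-∅        : D []
    vertices      : List (El A)
    face⊆vertices : ∀ α x → D α → Mem A x α → Mem A x vertices

-- Faces are not decidable, so a basis above a face exists only up to double negation;
-- this suffices because bases are only used to refute.
module Bases (A : Ty) (D : Complex A) (laws : ComplexLaws A D) where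
  open ComplexLaws laws
  open Families A
  private
    module A = Lists A

  Saturated : El (P A) → List (El A) → Set
  Saturated F vs = ∀ v → Mem A v vs → D (v ∷ F) → Mem A v F

  saturate : ∀ F → D F → ∀ vs → ¬ ¬ (∃[ F′ ] (D F′ × Sub A F F′ × Saturated F′ vs))
  saturate F dF []       k = k (F , dF , sub-refl F , λ v ())
  saturate F dF (v ∷ vs) k = ¬¬-excluded-middle λ
    { (yes dvF) → saturate (v ∷ F) dvF vs λ (F′ , dF′ , vF⊆F′ , sat) →
        k (F′ , dF′ , sub-trans F (v ∷ F) F′ F⊆vF vF⊆F′ , extend-added F′ vF⊆F′ sat)
    ; (no ¬dvF) → saturate F dF vs λ (F′ , dF′ , F⊆F′ , sat) →
        k (F′ , dF′ , F⊆F′ , extend-rejected F′ F⊆F′ ¬dvF sat) }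
    where
    F⊆vF : Sub A F (v ∷ F)
    F⊆vF = A.⊆⇒sub F (v ∷ F) (λ x m → A.mem-there x v F m)
    extend-added : ∀ F′ → Sub A (v ∷ F) F′ → Saturated F′ vs → Saturated F′ (v ∷ vs)
    extend-added F′ vF⊆F′ sat v′ h d with A.mem-∷⁻ v′ v vs h
    ... | inj₁ e  = A.mem-≈ F′ e (A.sub⇒⊆ (v ∷ F) F′ vF⊆F′ v (A.mem-here v F))
    ... | inj₂ h′ = sat v′ h′ d
    extend-rejected : ∀ F′ → Sub A F F′ → ¬ D (v ∷ F) → Saturated F′ vs → Saturated F′ (v ∷ vs)
    extend-rejected F′ F⊆F′ ¬dvF sat v′ h d with A.mem-∷⁻ v′ v vs h
    ... | inj₁ e  = ⊥-elim (¬dvF (face-downward (v ∷ F) (v′ ∷ F′) (A.⊆⇒sub (v ∷ F) (v′ ∷ F′) vF⊆v′F′) d))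
      where
      vF⊆v′F′ : (v ∷ F) A.⊆ (v′ ∷ F′)
      vF⊆v′F′ x x∈vF with A.mem-∷⁻ x v F x∈vF
      ... | inj₁ x≈v  = A.Any⇒mem (v′ ∷ F′) (here (A.≈-trans x v v′ x≈v (A.≈-sym v′ v e)))
      ... | inj₂ x∈F  = A.mem-there x v′ F′ (A.sub⇒⊆ F F′ F⊆F′ x x∈F)
    ... | inj₂ h′ = sat v′ h′ d

  basis-above : ∀ U → D U → ¬ ¬ (∃[ α ] (IsBasis A D α × Sub A U α))
  basis-above U dU k = saturate U dU vertices λ (F′ , dF′ , U⊆F′ , sat) →
    k (F′ , (dF′ , λ γ dγ F′⊆γ → A.⊆⇒sub γ F′ (λ y y∈γ →
        sat y (face⊆vertices γ y dγ y∈γ) (face-downward (y ∷ F′) γ (∧-true y∈γ F′⊆γ) dγ))) , U⊆F′)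

-- Nested sets

SumInjective : (Y A : Ty) → Complex A → (El A → El (T Y)) → Set
SumInjective Y A D w =
  ∀ L L′ → D L → D L′ → Eq (T Y) (concat (map w L)) (concat (map w L′)) → Eq (T A) L L′

module Nesting (A : Ty) (D : Complex A) (laws : ComplexLaws A D)
               (B : List (El (P A))) (building : IsBuildingSet A D B) where
  open ComplexLaws laws
  open Families A
  open Bases A D laws
  private
    module A = Lists A
    module PA = Lists (P A)

  Nested : El (P (P A)) → Set
  Nested = IsNested A D B

  restrict-mem⁺ : ∀ β α → Mem (P A) β B → Sub A β α → Mem (P A) β (restrict A B α)
  restrict-mem⁺ β α β∈B β⊆α = PA.mem-filter⁺ (λ γ → sub A γ α)
    (λ γ γ′ e γ⊆α → sub-trans γ′ γ α (eqP⇒sub γ′ γ (PA.≈-sym γ γ′ e)) γ⊆α) β B β∈B β⊆α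

  restrict-mem⁻ : ∀ β α → Mem (P A) β (restrict A B α) → Mem (P A) β B
  restrict-mem⁻ β α = PA.mem-filter⁻ (λ γ → sub A γ α) β B

  building-face : ∀ β → Mem (P A) β B → D β
  building-face β β∈B with find (PA.mem⇒Any B β∈B)
  ... | β′ , β′∈B , β≈β′ = face-resp-≈ β′ β (PA.≈-sym β β′ β≈β′) (All.lookup (proj₁ building) β′∈B)

  building-nonempty : ∀ β → Mem (P A) β B → ∃[ x ] Mem A x β
  building-nonempty []      ∅∈B = ⊥-elim (basis-above [] (building-face [] ∅∈B) λ (α , α-basis , _) →
    proj₁ (proj₁ (proj₂ building α α-basis) [] (restrict-mem⁺ [] α ∅∈B refl)) refl)
  building-nonempty (x ∷ β) _   = x , A.mem-here x β

  nested-⊆ : ∀ N N′ → Nested N → N′ PA.⊆ N → Nested N′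
  nested-⊆ N N′ (N⊆B , antichains) N′⊆N =
    (λ β β∈N′ → N⊆B β (N′⊆N β β∈N′)) ,
    λ βs (len , βs⊆N′ , incomparable) → antichains βs (len , All.map (λ {β} → N′⊆N β) βs⊆N′ , incomparable)

  Ñ-laws : ComplexLaws (P A) (Ñ A D B)
  Ñ-laws = record
    { face-resp-≈   = λ N N′ e nested → nested-⊆ N N′ nested (PA.eqP⇒⊆ N′ N (PA.eqP-sym N N′ e))
    ; face-downward = λ N N′ s nested → nested-⊆ N′ N nested (PA.sub⇒⊆ N N′ s)
    ; face-∅        = (λ β ()) , λ { (β ∷ βs) (_ , () ∷ _ , _) }
    ; vertices      = B
    ; face⊆vertices = λ N β nested β∈N → proj₁ nested β β∈N }

  -- The union of a nested set is that of its maxima, which form an antichain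
  -- unless there is at most one of them.
  concat-nested-face : ∀ N → Nested N → D (concat N)
  concat-nested-face N nested =
    face-resp-≈ (concat (maxima N)) (concat N) (PA.≈-sym (concat N) (concat (maxima N)) (concat-maxima-≈ N))
      (face-of-maxima (maxima N) (PA.dedup-distinct (map (top N) N)) (maxima⁻ N))
    where
    face-of-maxima : ∀ G → PA.Distinct G → (∀ g → Mem (P A) g G → Mem (P A) g N × Maximal N g) → D (concat G)
    face-of-maxima []           _ _     = face-∅
    face-of-maxima (m ∷ [])     _ G-max rewrite ++-identityʳ m =
      building-face m (proj₁ nested m (proj₁ (G-max m (PA.mem-here m []))))
    face-of-maxima (m ∷ m′ ∷ G) d G-max =
      proj₁ (proj₂ nested _ (antichain-of-maxima N (m ∷ m′ ∷ G) d G-max (s≤s (s≤s z≤n))))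

  meeting-maxima : El (P A) → List (El (P A)) → List (El (P A))
  meeting-maxima γ N = filterB (meets γ) (maxima N)

  ⊆concat-meeting-maxima : ∀ γ N → γ A.⊆ concat N → γ A.⊆ concat (meeting-maxima γ N)
  ⊆concat-meeting-maxima γ N γ⊆⋃N z z∈γ with find (mem-concat⁻ z N (γ⊆⋃N z z∈γ))
  ... | β , β∈N , z∈β with maxima-cover N β (PA.∈⇒mem N β∈N)
  ... | m , m∈M , β⊆m with find (PA.mem⇒Any (maxima N) m∈M)
  ... | m′ , m′∈M , m≈m′ = member⊆concat m′ (meeting-maxima γ N) m′∈G z z∈m′
    where
    z∈m′ : Mem A z m′
    z∈m′ = A.eqP⇒⊆ m m′ m≈m′ z (A.sub⇒⊆ β m β⊆m z z∈β)
    m′∈G : Mem (P A) m′ (meeting-maxima γ N)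
    m′∈G = PA.∈⇒mem _ (∈-filter⁺ (meets γ) m′∈M (meets⁺ γ m′ (z , z∈γ , z∈m′)))

  -- Two maxima meeting γ would form an antichain whose union is not in B, yet by
  -- (B1) inside a basis containing it, that union (which absorbs γ) is in B.
  meeting-maxima-length : ∀ N γ → Nested N → Mem (P A) γ B → γ A.⊆ concat N →
                          ¬ (2 ≤ length (meeting-maxima γ N))
  meeting-maxima-length N γ nested γ∈B γ⊆⋃N two =
    basis-above ⋃G ⋃G-face λ (α , α-basis , ⋃G⊆α) →
      ⋃G∉B (restrict-mem⁻ ⋃G α (PA.mem-≈ (restrict A B α) (++-absorbˡ-≈ γ ⋃G γ⊆⋃G)
        (building-++-meeting (restrict A B α) (proj₂ building α α-basis) γ G
          (restrict-mem⁺ γ α γ∈B (sub-trans γ ⋃G α γ⊆⋃G ⋃G⊆α))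
          (All.tabulate (λ {g} g∈G → G-in-restriction α ⋃G⊆α g g∈G)))))
    where
    G : List (El (P A))
    G = meeting-maxima γ N
    ⋃G : El (P A)
    ⋃G = concat G
    G-max : ∀ g → Mem (P A) g G → Mem (P A) g N × Maximal N g
    G-max g h = maxima⁻ N g (PA.mem-filter⁻ (meets γ) g (maxima N) h)
    antichain : IsAntichain A N G
    antichain = antichain-of-maxima N G
      (PA.filter-distinct (meets γ) (maxima N) (PA.dedup-distinct (map (top N) N))) G-max two
    ⋃G-face : D ⋃G
    ⋃G-face = proj₁ (proj₂ nested G antichain)
    ⋃G∉B : ¬ Mem (P A) ⋃G B
    ⋃G∉B = proj₂ (proj₂ nested G antichain)
    γ⊆⋃G : Sub A γ ⋃G
    γ⊆⋃G = A.⊆⇒sub γ ⋃G (⊆concat-meeting-maxima γ N γ⊆⋃N)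
    G-in-restriction : ∀ α → Sub A ⋃G α → ∀ g → g ∈ G → Mem (P A) g (restrict A B α) × Meets γ g
    G-in-restriction α ⋃G⊆α g g∈G =
      restrict-mem⁺ g α (proj₁ nested g (proj₁ (G-max g g∈G′)))
        (sub-trans g ⋃G α (A.⊆⇒sub g ⋃G (member⊆concat g G g∈G′)) ⋃G⊆α) ,
      meets⁻ γ g (proj₂ (∈-filter⁻ (meets γ) (maxima N) g∈G))
      where
      g∈G′ : Mem (P A) g G
      g∈G′ = PA.∈⇒mem G g∈G

  building⊆maximum : ∀ N γ δ x → Nested N → Mem (P A) γ B → γ A.⊆ concat N → Mem A x γ →
                     Mem (P A) δ (maxima N) → Mem A x δ → Sub A γ δ
  building⊆maximum N γ δ x nested γ∈B γ⊆⋃N x∈γ δ∈M x∈δ with sub A γ δ in γ⊆δ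
  ... | true  = refl
  ... | false with ¬sub⇒witness γ δ γ⊆δ | find (PA.mem⇒Any (maxima N) δ∈M)
  ...   | y , y∈γ , y∉δ | δ′ , δ′∈M , δ≈δ′
    with find (mem-concat⁻ y (meeting-maxima γ N) (⊆concat-meeting-maxima γ N γ⊆⋃N y y∈γ))
  ...     | ε , ε∈G , y∈ε = ⊥-elim (meeting-maxima-length N γ nested γ∈B γ⊆⋃N
                              (distinct-members⇒2≤length δ′∈G ε∈G δ′≢ε))
    where
    G : List (El (P A))
    G = meeting-maxima γ N
    δ′∈G : δ′ ∈ G
    δ′∈G = ∈-filter⁺ (meets γ) δ′∈M (meets⁺ γ δ′ (x , x∈γ , A.eqP⇒⊆ δ δ′ δ≈δ′ x x∈δ))
    δ′≢ε : δ′ ≢ ε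
    δ′≢ε refl = true≢false (trans (sym (A.eqP⇒⊆ δ′ δ (PA.≈-sym δ δ′ δ≈δ′) y y∈ε)) y∉δ)

  multiunion : List (El (P A)) → El (T A)
  multiunion L = concat (map (dedup A) L)

  concat⊆multiunion : ∀ L → concat L A.⊆ multiunion L
  concat⊆multiunion L x h = mem-concat⁺ x (map (dedup A) L)
    (Any.map⁺ (Any.map (λ {β} x∈β → trans (A.mem-dedup x β) x∈β) (mem-concat⁻ x L h)))

  multiunion⊆concat : ∀ L → multiunion L A.⊆ concat L
  multiunion⊆concat L x h = mem-concat⁺ x L
    (Any.map (λ {β} x∈β → trans (sym (A.mem-dedup x β)) x∈β)
             (Any.map⁻ (mem-concat⁻ x (map (dedup A) L) h)))

  ≋-multiunion⇒⊆ : ∀ L L′ → multiunion L A.≋ multiunion L′ → concat L A.⊆ concat L′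
  ≋-multiunion⇒⊆ L L′ h y y∈⋃L with A.mem⇒count≡suc (multiunion L) (concat⊆multiunion L y y∈⋃L)
  ... | n , c = multiunion⊆concat L′ y (A.count≡suc⇒mem (multiunion L′) n (trans (sym (h y)) c))

  -- β and the maximum of L′ through one of its points contain each other.
  maximum-shared : ∀ L L′ β → Nested L → Nested L′ → concat L A.⊆ concat L′ → concat L′ A.⊆ concat L →
                   Mem (P A) β (maxima L) → Mem (P A) β L′
  maximum-shared L L′ β nL nL′ L⊆L′ L′⊆L β∈M with maxima⁻ L β β∈M
  ... | β∈L , _ with building-nonempty β (proj₁ nL β β∈L)
  ... | x , x∈β with find (mem-concat⁻ x L′ (L⊆L′ x (member⊆concat β L β∈L x x∈β)))
  ... | β₁ , β₁∈L′ , x∈β₁ with maxima-cover L′ β₁ (PA.∈⇒mem L′ β₁∈L′)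
  ... | m , m∈M′ , β₁⊆m = PA.mem-≈ L′ (sub-antisym β m β⊆m m⊆β) m∈L′
    where
    x∈m : Mem A x m
    x∈m = A.sub⇒⊆ β₁ m β₁⊆m x x∈β₁
    m∈L′ : Mem (P A) m L′
    m∈L′ = proj₁ (maxima⁻ L′ m m∈M′)
    β⊆m : Sub A β m
    β⊆m = building⊆maximum L′ β m x nL′ (proj₁ nL β β∈L)
            (λ z h → L⊆L′ z (member⊆concat β L β∈L z h)) x∈β m∈M′ x∈m
    m⊆β : Sub A m β
    m⊆β = building⊆maximum L m β x nL (proj₁ nL′ m m∈L′)
            (λ z h → L′⊆L z (member⊆concat m L′ m∈L′ z h)) x∈m β∈M x∈β

  private
    module MU = ConcatMap (P A) A (dedup A)
                  (λ a a′ e → A.eqT⇒count≡ (dedup A a) (dedup A a′) (trans (A.eq-dedup a a′) e))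

  multiunion-injective : ∀ n L L′ → length L ≡ n → Nested L → Nested L′ →
                         multiunion L A.≋ multiunion L′ → L PA.≋ L′
  multiunion-injective zero    []        []        _ _ _ _ z = refl
  multiunion-injective zero    []        (β ∷ L′)  _ _ nL′ h z
    with building-nonempty β (proj₁ nL′ β (PA.mem-here β L′))
  ... | x , x∈β with trans (h x) (A.count-++ x (dedup A β) (multiunion L′))
  ...   | c rewrite A.count-dedup-mem x β x∈β with c
  ...     | ()
  multiunion-injective (suc n) L@(β₀ ∷ L₀) L′ len nL nL′ h z with maxima-cover L β₀ (PA.mem-here β₀ L₀)
  ... | β , β∈M , _ = begin
    count (P A) z L                          ≡⟨ PA.count-remove β L β∈L z ⟩
    count (P A) z (β ∷ R)                    ≡⟨ PA.count-∷-cong z β R R′ (multiunion-injective n R R′ lenR nR nR′ hR z) ⟩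
    count (P A) z (β ∷ R′)                   ≡⟨ sym (PA.count-remove β L′ β∈L′ z) ⟩
    count (P A) z L′                         ∎
    where
    open ≡-Reasoning
    R R′ : List (El (P A))
    R = PA.remove β L
    R′ = PA.remove β L′
    β∈L : Mem (P A) β L
    β∈L = proj₁ (maxima⁻ L β β∈M)
    β∈L′ : Mem (P A) β L′
    β∈L′ = maximum-shared L L′ β nL nL′ (≋-multiunion⇒⊆ L L′ h) (≋-multiunion⇒⊆ L′ L (λ y → sym (h y))) β∈M
    lenR : length R ≡ n
    lenR = suc-injective (trans (PA.length-remove β L β∈L) len)
    nR : Nested R
    nR = nested-⊆ L R nL (PA.mem-remove β L)
    nR′ : Nested R′
    nR′ = nested-⊆ L′ R′ nL′ (PA.mem-remove β L′)
    hR : multiunion R A.≋ multiunion R′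
    hR y = +-cancelˡ-≡ (count A y (dedup A β)) _ _
      (trans (sym (MU.count-concatMap-remove β L β∈L y))
             (trans (h y) (MU.count-concatMap-remove β L′ β∈L′ y)))

  multiunion-face : ∀ L → Nested L → D (multiunion L)
  multiunion-face L nL = face-resp-≈ (concat L) (multiunion L)
    (A.⊆⇒eqP (concat L) (multiunion L) (concat⊆multiunion L) (multiunion⊆concat L)) (concat-nested-face L nL)

  -- The sum over a nested set of the sums over its members is the sum over its multiunion.
  sum-injective-Ñ : ∀ Y (w : El A → El (T Y)) → SumInjective Y A D w →
                    SumInjective Y (P A) (Ñ A D B) (λ β → concat (map w (dedup A β)))
  sum-injective-Ñ Y w w-inj L L′ nL nL′ e =
    PA.count≡⇒eqT L L′ (multiunion-injective (length L) L L′ refl nL nL′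
      (A.eqT⇒count≡ (multiunion L) (multiunion L′)
        (w-inj (multiunion L) (multiunion L′) (multiunion-face L nL) (multiunion-face L′ nL′)
          (subst₂ (Eq (T Y)) (concat-map-concat-map w (dedup A) L) (concat-map-concat-map w (dedup A) L′) e))))

simplicial-complex-laws : ∀ A C → IsSimplicialComplex A C → ComplexLaws A C
simplicial-complex-laws A C (bases , bases≢[] , _ , face⇔) = record
  { face-resp-≈   = λ α α′ e c → proj₂ (face⇔ α′)
      (Any.map (sub-trans α′ α _ (eqP⇒sub α′ α (PA.≈-sym α α′ e))) (proj₁ (face⇔ α) c))
  ; face-downward = λ α β α⊆β c → proj₂ (face⇔ α) (Any.map (sub-trans α β _ α⊆β) (proj₁ (face⇔ β) c))
  ; face-∅        = proj₂ (face⇔ []) (∅⊆some-basis bases bases≢[])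
  ; vertices      = concat bases
  ; face⊆vertices = λ α x c x∈α →
      mem-concat⁺ x bases (Any.map (λ {β} α⊆β → Lists.sub⇒⊆ A α β α⊆β x x∈α) (proj₁ (face⇔ α) c)) }
  where
  open Families A
  module PA = Lists (P A)
  ∅⊆some-basis : ∀ bs → bs ≢ [] → Any (Sub A []) bs
  ∅⊆some-basis []       bs≢[] = ⊥-elim (bs≢[] refl)
  ∅⊆some-basis (b ∷ bs) _     = here refl

sum-injective-resp : ∀ {Y A D} {w w′ : El A → El (T Y)} → SumInjective Y A D w → (∀ v → w v ≡ w′ v) →
                     SumInjective Y A D w′
sum-injective-resp {Y} w-inj w≗w′ L L′ dL dL′ e =
  w-inj L L′ dL dL′ (subst₂ (Eq (T Y)) (cong concat (map-cong (sym ∘ w≗w′) L))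
                                       (cong concat (map-cong (sym ∘ w≗w′) L′)) e)

module Iterated (k : ℕ) (C : Complex (X k)) (sc : IsSimplicialComplex (X k) C) where

  singleton-sum-injective : SumInjective (X k) (X k) C [_]
  singleton-sum-injective L L′ _ _ = subst₂ (Eq (T (X k))) (concat-map-[ L ]) (concat-map-[ L′ ])

  levels : ∀ n (bs : Builds k n) → ValidBuilds C bs →
    ComplexLaws (Pp (suc n) (X k)) (Ñs C bs) × SumInjective (X k) (Pp (suc n) (X k)) (Ñs C bs) (flatten (X k) n)
  levels zero (bld₀ B) building =
    Ñ-laws , sum-injective-resp (sum-injective-Ñ (X k) [_] singleton-sum-injective)
                                (λ v → concat-map-[ dedup (X k) v ])
    where open Nesting (X k) C (simplicial-complex-laws (X k) C sc) B building
  levels (suc n) (bs ▷ B) (valid , building) with levels n bs valid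
  ... | laws , flatten-inj =
    Ñ-laws , sum-injective-resp (sum-injective-Ñ (X k) (flatten (X k) n) flatten-inj) (sym ∘ flatten-suc (X k) n)
    where open Nesting (Pp (suc n) (X k)) (Ñs C bs) laws B building

-- Ss for an arbitrary complex D of P_F^{n+1} Y in place of Ñ(C,B₀,…,Bₙ)
Flattened : ∀ Y n → Complex (Pp (suc n) Y) → Complex (T Y)
Flattened Y n D α =
  ∃[ β ] ((∃[ N ] (D N × Eq (P (Tp (suc n) Y)) β (map (σ^ Y n) N))) × Eq (P (T Y)) α (map (μ^ Y n) β))

eqT-singleton : ∀ A u v → Eq (T A) [ u ] [ v ] → Eq A u v
eqT-singleton A u v e with Lists.mem⇒count≡suc A [ u ] (Lists.mem-here A u [])
... | n , c
  with Lists.mem-∷⁻ A u v [] (Lists.count≡suc⇒mem A [ v ] n (trans (sym (Lists.eqT⇒count≡ A [ u ] [ v ] e u)) c))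
...   | inj₁ u≈v = u≈v

module Flattening (Y : Ty) (n : ℕ) (D : Complex (Pp (suc n) Y)) (laws : ComplexLaws (Pp (suc n) Y) D)
                  (flatten-inj : SumInjective Y (Pp (suc n) Y) D (flatten Y n)) where
  open ComplexLaws laws
  private
    A : Ty
    A = Pp (suc n) Y
    ψ : El A → El (T Y)
    ψ = flatten Y n
    module A = Lists A
    module TY = Lists (T Y)
    module PTY = Lists (P (T Y))
    module μ-image = Image (Tp (suc n) Y) (T Y) (μ^ Y n)
                           (λ a a′ e → Lists.count≡⇒eqT Y (μ^ Y n a) (μ^ Y n a′) (μ^-resp-≈ Y n a a′ e))
    module ψ-image = Image A (T Y) ψ (flatten-resp-≈ Y n)

  flatten-injective : ∀ u v → InUnion A D u → InUnion A D v → Eq (T Y) (ψ u) (ψ v) → Eq A u v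
  flatten-injective u v (α , dα , u∈α) (β , dβ , v∈β) e = eqT-singleton A u v
    (flatten-inj [ u ] [ v ] (face-downward [ u ] α (∧-true u∈α refl) dα)
                             (face-downward [ v ] β (∧-true v∈β refl) dβ)
      (subst₂ (Eq (T Y)) (sym (++-identityʳ (ψ u))) (sym (++-identityʳ (ψ v))) e))

  image-flattened : ∀ N → D N → Flattened Y n D (map ψ N)
  image-flattened N dN = map (σ^ Y n) N , (N , dN , Lists.≈-refl (P (Tp (suc n) Y)) (map (σ^ Y n) N)) ,
    subst (Eq (P (T Y)) (map ψ N)) (map-∘ N) (PTY.≈-refl (map ψ N))

  flattened-image : ∀ α → Flattened Y n D α → ∃[ N ] (D N × Eq (P (T Y)) α (map ψ N))
  flattened-image α (β , (N , dN , β≈σN) , α≈μβ) = N , dN ,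
    PTY.≈-trans α (map (μ^ Y n) β) (map ψ N) α≈μβ
      (subst (Eq (P (T Y)) (map (μ^ Y n) β)) (sym (map-∘ N)) (μ-image.image-resp-≈ β (map (σ^ Y n) N) β≈σN))

  in-union-resp-≈ : ∀ u u′ → Eq A u u′ → InUnion A D u → InUnion A D u′
  in-union-resp-≈ u u′ e (α , dα , u∈α) = α , dα , A.mem-≈ α (A.≈-sym u u′ e) u∈α

  flatten-underlies : Underlies A (T Y) ψ D (Flattened Y n D)
  flatten-underlies =
      flatten-resp-≈ Y n
    , (λ v (α , dα , v∈α) → map ψ α , image-flattened α dα , mem-map⁺ A (T Y) ψ (flatten-resp-≈ Y n) v α v∈α)
    , flatten-injective
    , surjective
    , λ α α⊆⋃D → image-flattened α , reflect α α⊆⋃D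
    where
    surjective : ∀ w → InUnion (T Y) (Flattened Y n D) w → ∃[ v ] (InUnion A D v × Eq (T Y) (ψ v) w)
    surjective w (α , fα , w∈α) with flattened-image α fα
    ... | N , dN , α≈ψN with mem-map⁻ A (T Y) ψ w N (TY.eqP⇒⊆ α (map ψ N) α≈ψN w w∈α)
    ...   | u , u∈N , w≈ψu = u , (N , dN , A.∈⇒mem N u∈N) , TY.≈-sym w (ψ u) w≈ψu
    reflect : ∀ α → All (InUnion A D) α → Flattened Y n D (map ψ α) → D α
    reflect α α⊆⋃D fα with flattened-image (map ψ α) fα
    ... | N , dN , ψα≈ψN = face-resp-≈ N α
      (ψ-image.image-injective (InUnion A D) flatten-injective N α (λ u u∈N → N , dN , u∈N) in-union
        (TY.eqP-sym (map ψ α) (map ψ N) ψα≈ψN)) dN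
      where
      in-union : ∀ a → Mem A a α → InUnion A D a
      in-union a a∈α with find (A.mem⇒Any α a∈α)
      ... | a′ , a′∈α , a≈a′ = in-union-resp-≈ a′ a (A.≈-sym a a′ a≈a′) (All.lookup α⊆⋃D a′∈α)

theorem6p8 : (k : ℕ) (C : Complex (X k)) → IsSimplicialComplex (X k) C →
    (n : ℕ) (bs : Builds k n) → ValidBuilds C bs →
    Underlies (Pp (suc n) (X k)) (T (X k)) (μ^ (X k) n ∘ σ^ (X k) n) (Ñs C bs) (Ss C bs)
theorem6p8 k C sc n bs valid with Iterated.levels k C sc n bs valid
... | laws , flatten-inj = Flattening.flatten-underlies (X k) n (Ñs C bs) laws flatten-inj
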